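{- Let $\mathcal{P}$ be a minimum path cover of a tree $T$ and let $e=xy$ be a connector edge of $\mathcal{P}$. Then at least one of $x,y$ is an interior connector vertex.
   Context: A path cover of a tree $T$ is a set of vertex-disjoint paths of $T$ (a path may consist of a single vertex) whose vertex sets cover $V(T)$; it is minimum if it has the fewest paths among all path covers. For a path cover $\mathcal{P}$, an edge $xy$ of $T$ with $x$ and $y$ in different paths of $\mathcal{P}$ is a connector edge, and $x,y$ are connector vertices; a connector vertex is interior if it is not an end-vertex of the path of $\mathcal{P}$ containing it. -}

module Defs where

open import Level using (0ℓ)
open import Data.Nat using (ℕ; _≤_; _≥_)
open import Data.Fin using (Fin)
open import Data.Maybe using (just)
open import Data.List using (List; []; _∷_; length; head; last; concat)
open import Data.List.Membership.Propositional using (_∈_)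
open import Data.List.Relation.Unary.All using (All)
open import Data.List.Relation.Unary.Unique.Propositional using (Unique)
open import Data.List.Relation.Unary.Linked using (Linked)
open import Data.Product using (Σ; _×_; ∃; ∃-syntax)
open import Data.Sum using (_⊎_)
open import Data.Empty using (⊥)
open import Relation.Nullary using (¬_)
open import Relation.Binary.PropositionalEquality using (_≡_)

record Graph (n : ℕ) : Set₁ where
  field
    Adj    : Fin n → Fin n → Set
    sym    : ∀ {u v} → Adj u v → Adj v u
    irrefl : ∀ {u} → ¬ Adj u u

module _ {n : ℕ} (G : Graph n) where
  open Graph G

  Walk : Fin n → Fin n → List (Fin n) → Set
  Walk u v w = Linked Adj w × head w ≡ just u × last w ≡ just v

  Connected : Set
  Connected = ∀ u v → ∃[ w ] Walk u v w

  IsCycle : List (Fin n) → Set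
  IsCycle c = 3 ≤ length c × Unique c × Linked Adj c ×
              ∃[ a ] ∃[ b ] (head c ≡ just a × last c ≡ just b × Adj b a)

  Acyclic : Set
  Acyclic = ∀ c → ¬ IsCycle c

  IsTree : Set
  IsTree = Connected × Acyclic

  IsPath : List (Fin n) → Set
  IsPath p = 1 ≤ length p × Unique p × Linked Adj p

  IsPathCover : List (List (Fin n)) → Set
  IsPathCover P = All IsPath P × Unique (concat P) × (∀ v → v ∈ concat P)

  IsMinimumPathCover : List (List (Fin n)) → Set
  IsMinimumPathCover P = IsPathCover P × (∀ Q → IsPathCover Q → length P ≤ length Q)

  SamePath : List (List (Fin n)) → Fin n → Fin n → Set
  SamePath P x y = ∃[ p ] (p ∈ P × x ∈ p × y ∈ p)

  IsConnectorEdge : List (List (Fin n)) → Fin n → Fin n → Set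
  IsConnectorEdge P x y = Adj x y × ¬ SamePath P x y

  IsConnectorVertex : List (List (Fin n)) → Fin n → Set
  IsConnectorVertex P x = ∃[ y ] IsConnectorEdge P x y

  IsEnd : List (Fin n) → Fin n → Set
  IsEnd p x = head p ≡ just x ⊎ last p ≡ just x

  IsInteriorConnector : List (List (Fin n)) → Fin n → Set
  IsInteriorConnector P x =
    IsConnectorVertex P x × (∀ p → p ∈ P → x ∈ p → ¬ IsEnd p x)

{-# OPTIONS --safe #-}
-- If both ends x and y of a connector edge were end-vertices of their paths,
-- then orienting the two paths so that one ends in x and the other starts
-- in y and joining them along xy would give a path cover with one path fewer.
module Submission where

open import Defs
open import Data.Nat using (ℕ; _≤_; _<_; s≤s; z≤n)
open import Data.Nat.Properties using (<⇒≱; n<1+n)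
open import Data.Fin using (Fin) renaming (_≟_ to _≟ᶠ_)
open import Data.Maybe using (just)
import Data.Maybe.Properties as Maybe
open import Data.Maybe.Relation.Binary.Connected using (just) renaming (Connected to Connectedᵐ)
open import Data.List using (List; []; _∷_; _++_; _∷ʳ_; length; head; last; concat; reverse)
open import Data.List.Properties using (unfold-reverse; reverse-involutive; ++-assoc)
open import Data.List.Membership.Propositional using (_∈_; lose; find)
open import Data.List.Membership.Propositional.Properties using (∈-∃++)
import Data.List.Membership.DecPropositional as DecMembership
open import Data.List.Relation.Unary.All using (_∷_)
import Data.List.Relation.Unary.All.Properties as All
open import Data.List.Relation.Unary.Any using (here; there; any?)
open import Data.List.Relation.Unary.Unique.Propositional using (Unique)
open import Data.List.Relation.Unary.AllPairs using ([]; _∷_)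
open import Data.List.Relation.Unary.Linked using (Linked; []; [-]; _∷_)
import Data.List.Relation.Unary.Linked.Properties as Linked
open import Data.List.Relation.Binary.Permutation.Propositional
open import Data.List.Relation.Binary.Permutation.Propositional.Properties
  using (++⁺; ++⁺ˡ; shift; shifts; ↭-reverse; All-resp-↭; ∈-resp-↭; ↭-length)
import Data.List.Relation.Binary.Permutation.Setoid.Properties as Permutationₛ
open import Data.Product using (_×_; _,_; proj₂; ∃-syntax)
open import Data.Sum using (_⊎_; inj₁; inj₂)
open import Data.Empty using (⊥; ⊥-elim)
open import Relation.Nullary using (Dec; yes; no; contradiction)
open import Relation.Nullary.Decidable using (_×-dec_; _⊎-dec_)
open import Relation.Binary.PropositionalEquality using (_≡_; _≢_; refl; cong; setoid)
import Relation.Binary.PropositionalEquality as ≡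

module _ {A : Set} where

  last-∷ʳ : (xs : List A) (x : A) → last (xs ∷ʳ x) ≡ just x
  last-∷ʳ []           x = refl
  last-∷ʳ (_ ∷ [])     x = refl
  last-∷ʳ (_ ∷ y ∷ ys) x = last-∷ʳ (y ∷ ys) x

  last-reverse : (xs : List A) → last (reverse xs) ≡ head xs
  last-reverse []       = refl
  last-reverse (x ∷ xs) = ≡.trans (cong last (unfold-reverse x xs)) (last-∷ʳ (reverse xs) x)

  head-reverse : (xs : List A) → head (reverse xs) ≡ last xs
  head-reverse xs = ≡.trans (≡.sym (last-reverse (reverse xs))) (cong last (reverse-involutive xs))

  Linked-reverse : {R : A → A → Set} → (∀ {u v} → R u v → R v u) →
                   {xs : List A} → Linked R xs → Linked R (reverse xs)
  Linked-reverse sym-R []  = []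
  Linked-reverse sym-R [-] = [-]
  Linked-reverse {R} sym-R {x ∷ y ∷ ys} (r ∷ l) rewrite unfold-reverse x (y ∷ ys) =
    Linked.++⁺ (Linked-reverse sym-R l) connected [-]
    where
    connected : Connectedᵐ R (last (reverse (y ∷ ys))) (just x)
    connected rewrite last-reverse (y ∷ ys) = just (sym-R r)

  Unique-++⁻ˡ : (xs : List A) {ys : List A} → Unique (xs ++ ys) → Unique xs
  Unique-++⁻ˡ []       u       = []
  Unique-++⁻ˡ (x ∷ xs) (a ∷ u) = All.++⁻ˡ xs a ∷ Unique-++⁻ˡ xs u

  Unique-resp-↭ : {xs ys : List A} → xs ↭ ys → Unique xs → Unique ys
  Unique-resp-↭ p = Permutationₛ.Unique-resp-↭ (setoid A) (↭⇒↭ₛ p)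

  concat⁺ : {xss yss : List (List A)} → xss ↭ yss → concat xss ↭ concat yss
  concat⁺ refl           = ↭-refl
  concat⁺ (prep xs p)    = ++⁺ˡ xs (concat⁺ p)
  concat⁺ (swap xs ys p) = ↭-trans (shifts xs ys) (++⁺ˡ ys (++⁺ˡ xs (concat⁺ p)))
  concat⁺ (trans p q)    = ↭-trans (concat⁺ p) (concat⁺ q)

  ∈-∈-↭ : {x y : A} {xs : List A} → x ∈ xs → y ∈ xs → x ≢ y → ∃[ ys ] xs ↭ x ∷ y ∷ ys
  ∈-∈-↭ x∈xs y∈xs x≢y with ∈-∃++ x∈xs
  ... | us , vs , refl with ∈-resp-↭ (shift _ us vs) y∈xs
  ...   | here y≡x = contradiction (≡.sym y≡x) x≢y
  ...   | there y∈usvs with ∈-∃++ y∈usvs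
  ...     | ws , zs , eq =
    ws ++ zs , ↭-trans (shift _ us vs) (prep _ (↭-trans (↭-reflexive eq) (shift _ ws zs)))

module _ {n : ℕ} (G : Graph n) where
  open Graph G
  open DecMembership (_≟ᶠ_ {n}) using (_∈?_)

  IsEnd? : (p : List (Fin n)) (v : Fin n) → Dec (IsEnd G p v)
  IsEnd? p v = Maybe.≡-dec _≟ᶠ_ (head p) (just v) ⊎-dec Maybe.≡-dec _≟ᶠ_ (last p) (just v)

  IsConnectorEdge-sym : ∀ {P x y} → IsConnectorEdge G P x y → IsConnectorEdge G P y x
  IsConnectorEdge-sym (xy , ¬same) =
    sym xy , λ (p , p∈P , y∈p , x∈p) → ¬same (p , p∈P , x∈p , y∈p)

  interior⊎end : ∀ {P v w} → IsConnectorEdge G P v w →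
                 IsInteriorConnector G P v ⊎ ∃[ p ] (p ∈ P × v ∈ p × IsEnd G p v)
  interior⊎end {P} {v} {w} vw with any? (λ p → (v ∈? p) ×-dec IsEnd? p v) P
  ... | yes end = inj₂ (find end)
  ... | no ¬end = inj₁ ((w , vw) , λ p p∈P v∈p e → ¬end (lose p∈P (v∈p , e)))

  ending-at : ∀ {p v} → Linked Adj p → IsEnd G p v →
              ∃[ q ] (q ↭ p × Linked Adj q × last q ≡ just v)
  ending-at     l (inj₂ e) = _ , ↭-refl , l , e
  ending-at {p} l (inj₁ e) =
    reverse p , ↭-reverse p , Linked-reverse sym l , ≡.trans (last-reverse p) e

  starting-at : ∀ {p v} → Linked Adj p → IsEnd G p v →
                ∃[ q ] (q ↭ p × Linked Adj q × head q ≡ just v)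
  starting-at     l (inj₁ e) = _ , ↭-refl , l , e
  starting-at {p} l (inj₂ e) =
    reverse p , ↭-reverse p , Linked-reverse sym l , ≡.trans (head-reverse p) e

  IsPathCover-resp-↭ : ∀ {P Q} → P ↭ Q → IsPathCover G P → IsPathCover G Q
  IsPathCover-resp-↭ σ (paths , unique , covers) =
    All-resp-↭ σ paths , Unique-resp-↭ (concat⁺ σ) unique , λ v → ∈-resp-↭ (concat⁺ σ) (covers v)

  join-ends : ∀ {p q R x y} → IsPathCover G (p ∷ q ∷ R) →
              IsEnd G p x → IsEnd G q y → Adj x y → ∃[ r ] IsPathCover G (r ∷ R)
  join-ends {p} {q} {R} ((path-p ∷ path-q ∷ paths) , unique , covers) px qy xy
    with ending-at (proj₂ (proj₂ path-p)) px | starting-at (proj₂ (proj₂ path-q)) qy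
  ... | p′ , σ , linked-p′ , last-p′ | q′ , τ , linked-q′ , head-q′ =
    p′ ++ q′ , (path ∷ paths) , unique′ , λ v → ∈-resp-↭ reorder (covers v)
    where
    reorder : concat (p ∷ q ∷ R) ↭ concat ((p′ ++ q′) ∷ R)
    reorder = ↭-trans (++⁺ (↭-sym σ) (++⁺ (↭-sym τ) ↭-refl))
                      (↭-reflexive (≡.sym (++-assoc p′ q′ (concat R))))

    unique′ : Unique (concat ((p′ ++ q′) ∷ R))
    unique′ = Unique-resp-↭ reorder unique

    nonempty : ∀ {xs : List (Fin n)} {ys a} → last xs ≡ just a → 1 ≤ length (xs ++ ys)
    nonempty {_ ∷ _} _ = s≤s z≤n

    path : IsPath G (p′ ++ q′)
    path = nonempty {p′} {q′} last-p′ , Unique-++⁻ˡ (p′ ++ q′) unique′ ,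
           Linked.++⁺ linked-p′ (≡.subst₂ (Connectedᵐ Adj) (≡.sym last-p′) (≡.sym head-q′) (just xy)) linked-q′

  ¬connector-between-ends : ∀ {P x y px py} → IsMinimumPathCover G P → IsConnectorEdge G P x y →
    px ∈ P → x ∈ px → IsEnd G px x → py ∈ P → y ∈ py → IsEnd G py y → ⊥
  ¬connector-between-ends {P} (cover , minimum) (xy , ¬same) px∈P x∈px px-x py∈P y∈py py-y
    with ∈-∈-↭ px∈P py∈P (λ { refl → ¬same (_ , px∈P , x∈px , y∈py) })
  ... | R , σ with join-ends (IsPathCover-resp-↭ σ cover) px-x py-y xy
  ... | r , cover′ = <⇒≱ fewer (minimum (r ∷ R) cover′)
    where
    fewer : length (r ∷ R) < length P
    fewer = ≡.subst (length (r ∷ R) <_) (≡.sym (↭-length σ)) (n<1+n _)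

lemma3p5 : (n : ℕ) (T : Graph n) → IsTree T →
    (P : List (List (Fin n))) → IsMinimumPathCover T P →
    (x y : Fin n) → IsConnectorEdge T P x y →
    IsInteriorConnector T P x ⊎ IsInteriorConnector T P y
lemma3p5 n T _ P minimum x y xy
  with interior⊎end T xy | interior⊎end T (IsConnectorEdge-sym T xy)
... | inj₁ x-interior | _              = inj₁ x-interior
... | inj₂ _          | inj₁ y-interior = inj₂ y-interior
... | inj₂ (px , px∈P , x∈px , px-x) | inj₂ (py , py∈P , y∈py , py-y) =
  ⊥-elim (¬connector-between-ends T minimum xy px∈P x∈px px-x py∈P y∈py py-y)
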